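{- Let $k,\ell$ be integers with $k\geq \ell+2$. Let $T$ be an $\ell$-complete tree decomposition of a graph $G=(V,E)$, rooted at a node $u$. Let $\alpha$ be a $(V\setminus B_u)$-coherent proper $k$-coloring of $G$ such that some color $a$ does not appear on $B_u$. Then there is a sequence of proper $k$-colorings, consecutive ones differing on exactly one vertex, from $\alpha$ to a $(V\setminus B_u)$-coherent proper $k$-coloring in which no vertex has color $a$, in which no vertex of $B_u$ is recolored and every vertex of $V\setminus B_u$ is recolored at most once.
   Context: A tree decomposition of $G$ is a tree $T$ with bags $B_w\subseteq V$ such that every edge lies in some bag and for every vertex the nodes whose bags contain it form a non-empty subtree. It is $\ell$-complete if every bag has exactly $\ell+1$ vertices and adjacent nodes $w,w'$ satisfy $|B_w\cap B_{w'}|=\ell$. Two vertices $x,y$ are parents if there is an edge $ww'$ of $T$ with $B_w\setminus B_{w'}=\{x\}$ and $B_{w'}\setminus B_w=\{y\}$. For $X\subseteq V$, a coloring $\alpha$ is $X$-coherent if $\alpha(x)=\alpha(y)$ for all parents $x,y\in X$, and for every bag $B$ and every $x\in X\cap B$, $x$ is the only vertex of $B$ colored $\alpha(x)$. A proper $k$-coloring assigns colors from $\{1,\dots,k\}$ with adjacent vertices receiving distinct colors. -}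

module Defs where

open import Data.Nat using (ℕ; zero; suc)
open import Data.Fin using (Fin; zero; suc; inject₁)
open import Data.Fin.Subset using (Subset; _∈_; _∉_; _∩_; _─_; ⁅_⁆; ∣_∣)
open import Data.Product using (Σ; ∃; _×_; _,_)
open import Data.Sum using (_⊎_)
open import Relation.Nullary using (¬_)
open import Relation.Binary.PropositionalEquality using (_≡_; _≢_)

record Graph (n : ℕ) : Set₁ where
  field
    Adj      : Fin n → Fin n → Set
    symAdj   : ∀ {x y} → Adj x y → Adj y x
    loopless : ∀ {x} → ¬ Adj x x
open Graph public

-- Finite trees on node set Fin m, presented as rooted at a node r by a
-- parent map whose depth strictly decreases towards r (so the
-- underlying graph {w, parent w} (w ≠ r) is a tree).

record RootedTree (m : ℕ) (r : Fin m) : Set where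
  field
    parent     : Fin m → Fin m
    depth      : Fin m → ℕ
    depth-root : depth r ≡ 0
    depth-step : ∀ w → w ≢ r → depth w ≡ suc (depth (parent w))
open RootedTree public

TEdge : ∀ {m r} → RootedTree m r → Fin m → Fin m → Set
TEdge {r = r} T w w' = (w ≢ r × parent T w ≡ w') ⊎ (w' ≢ r × parent T w' ≡ w)

data PathIn {m r} (T : RootedTree m r) (S : Fin m → Set) : Fin m → Fin m → Set where
  here : ∀ {w} → S w → PathIn T S w w
  step : ∀ {w v w'} → S w → TEdge T w v → PathIn T S v w' → PathIn T S w w'

record TreeDecomposition {n : ℕ} (G : Graph n) (m : ℕ) (r : Fin m) : Set₁ where
  field
    tree    : RootedTree m r
    bag     : Fin m → Subset n
    covers  : ∀ x y → Adj G x y → ∃ λ w → x ∈ bag w × y ∈ bag w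
    nonempty  : ∀ x → ∃ λ w → x ∈ bag w
    connected : ∀ x w w' → x ∈ bag w → x ∈ bag w' →
                PathIn tree (λ t → x ∈ bag t) w w'
open TreeDecomposition public

IsComplete : ∀ {n m r} {G : Graph n} → ℕ → TreeDecomposition G m r → Set
IsComplete ℓ D =
  (∀ w → ∣ bag D w ∣ ≡ suc ℓ) ×
  (∀ w w' → TEdge (tree D) w w' → ∣ bag D w ∩ bag D w' ∣ ≡ ℓ)

Parents : ∀ {n m r} {G : Graph n} → TreeDecomposition G m r → Fin n → Fin n → Set
Parents D x y = ∃ λ w → ∃ λ w' → TEdge (tree D) w w' ×
  (bag D w ─ bag D w' ≡ ⁅ x ⁆) × (bag D w' ─ bag D w ≡ ⁅ y ⁆)

-- Colorings with colors {1,…,k} represented as Fin k.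

Coloring : ℕ → ℕ → Set
Coloring n k = Fin n → Fin k

Proper : ∀ {n k} → Graph n → Coloring n k → Set
Proper G α = ∀ x y → Adj G x y → α x ≢ α y

Coherent : ∀ {n m r k} {G : Graph n} → TreeDecomposition G m r →
           (Fin n → Set) → Coloring n k → Set
Coherent D X α =
  (∀ x y → X x → X y → Parents D x y → α x ≡ α y) ×
  (∀ w x → X x → x ∈ bag D w → ∀ z → z ∈ bag D w → α z ≡ α x → z ≡ x)

Recolored : ∀ {n k} → Coloring n k → Coloring n k → Fin n → Set
Recolored β γ v = β v ≢ γ v

DifferOnOne : ∀ {n k} → Coloring n k → Coloring n k → Set
DifferOnOne β γ = ∃ λ v → β v ≢ γ v × (∀ z → z ≢ v → β z ≡ γ z)

module Submission where

-- Bags have ℓ + 1 < k vertices, so every node w has a colour fresh w missing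
-- from α on its bag.  Going down from the root u we carry a colour banned w
-- absent from B w: banned u = a, and a child keeps its parent's colour when
-- that colour is absent from its bag, otherwise it is "active" and switches
-- to its own fresh colour.  A vertex v ∉ B u is moved when an active node e
-- above the node introducing v has banned (parent e) = α v; it then gets
-- fresh e.  The sequence from α to β comes from a general reconfiguration
-- lemma: recolour pending vertices one at a time in order of decreasing key
-- (the depth of the trigger node), which is safe because a neighbour holding
-- the target colour of x always has a deeper trigger.

open import Defs
open import Data.Nat using (ℕ; zero; suc; _+_; _≤_; _<_; z≤n; s≤s; s≤s⁻¹)
open import Data.Nat.Properties
  using (+-suc; +-comm; +-cancelʳ-≡; +-monoʳ-≤; ≤-refl; ≤-reflexive; ≤-trans; n≤1+n;
         suc-injective; <-irrefl; n≮n; <-≤-trans; ≤-totalOrder)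
open import Data.Vec using ([]; _∷_; here; there; tabulate)
open import Data.Vec.Properties using (lookup∘tabulate; lookup⇒[]=; []=⇒lookup)
open import Data.Vec.Functional using (updateAt)
open import Data.Vec.Functional.Properties using (updateAt-updates; updateAt-minimal)
open import Data.Fin using (Fin; zero; suc; inject₁; fromℕ; _≟_)
open import Data.Fin.Properties using (any?)
open import Data.Fin.Subset
  using (Subset; inside; outside; _∈_; _∉_; _─_; _∩_; _∪_; ⁅_⁆; ∣_∣; ⊤; _⊂_) renaming (⊥ to ∅)
open import Data.Fin.Subset.Properties
  using (_∈?_; x∈⁅x⁆; ∣⁅x⁆∣≡1; ∣⊥∣≡0; ∣⊤∣≡n; p⊆q⇒∣p∣≤∣q∣; p⊂q⇒∣p∣<∣q∣; x∈p∪q⁺;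
         x∈p∧x∉q⇒x∈p─q; Empty-unique)
open import Data.List using (List; filter; allFin)
import Data.List.Relation.Unary.All as All
open import Data.List.Membership.Propositional.Properties using (∈-filter⁺; ∈-filter⁻; ∈-allFin)
open import Data.List.Extrema ≤-totalOrder using (argmax; argmax-all; f[xs]≤f[argmax])
open import Data.Product using (Σ; ∃; _×_; _,_; proj₁; proj₂)
open import Data.Sum using (_⊎_; inj₁; inj₂)
open import Data.Empty using (⊥; ⊥-elim)
open import Function using (_∘_)
open import Relation.Nullary using (¬_; Dec; does; yes; no; ¬?)
open import Relation.Nullary.Decidable using (decidable-stable; map′; _×-dec_; dec-true; dec-false)
open import Relation.Binary.PropositionalEquality

private variable n k : ℕ

∈─⁻ : ∀ {x : Fin n} (p q : Subset n) → x ∈ p ─ q → x ∈ p × x ∉ q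
∈─⁻ (inside ∷ p) (outside ∷ q) here = here , λ ()
∈─⁻ (s ∷ p) (t ∷ q) (there x∈) with ∈─⁻ p q x∈
... | x∈p , x∉q = there x∈p , λ { (there x∈q) → x∉q x∈q }
∈─⁻ {x = zero} (outside ∷ p) (outside ∷ q) ()
∈─⁻ {x = zero} (s ∷ p) (inside ∷ q) ()

∣p∣≡∣p─q∣+∣p∩q∣ : ∀ (p q : Subset n) → ∣ p ∣ ≡ ∣ p ─ q ∣ + ∣ p ∩ q ∣
∣p∣≡∣p─q∣+∣p∩q∣ [] [] = refl
∣p∣≡∣p─q∣+∣p∩q∣ (inside ∷ p) (inside ∷ q) = trans (cong suc (∣p∣≡∣p─q∣+∣p∩q∣ p q)) (sym (+-suc _ _))
∣p∣≡∣p─q∣+∣p∩q∣ (inside ∷ p) (outside ∷ q) = cong suc (∣p∣≡∣p─q∣+∣p∩q∣ p q)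
∣p∣≡∣p─q∣+∣p∩q∣ (outside ∷ p) (inside ∷ q) = ∣p∣≡∣p─q∣+∣p∩q∣ p q
∣p∣≡∣p─q∣+∣p∩q∣ (outside ∷ p) (outside ∷ q) = ∣p∣≡∣p─q∣+∣p∩q∣ p q

∣p∣≡0⇒x∉p : ∀ (p : Subset n) → ∣ p ∣ ≡ 0 → ∀ {x} → x ∉ p
∣p∣≡0⇒x∉p (outside ∷ p) e (there x∈p) = ∣p∣≡0⇒x∉p p e x∈p

∣p∣≡1⇒nonempty : ∀ (p : Subset n) → ∣ p ∣ ≡ 1 → ∃ λ x → x ∈ p
∣p∣≡1⇒nonempty (inside ∷ p) e = zero , here
∣p∣≡1⇒nonempty (outside ∷ p) e with ∣p∣≡1⇒nonempty p e
... | x , x∈p = suc x , there x∈p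

∣p∣≡1⇒p≡⁅x⁆ : ∀ (p : Subset n) → ∣ p ∣ ≡ 1 → ∀ {x} → x ∈ p → p ≡ ⁅ x ⁆
∣p∣≡1⇒p≡⁅x⁆ (inside ∷ p) e here =
  cong (inside ∷_) (Empty-unique (λ (_ , y∈p) → ∣p∣≡0⇒x∉p p (suc-injective e) y∈p))
∣p∣≡1⇒p≡⁅x⁆ (inside ∷ p) e (there x∈p) = ⊥-elim (∣p∣≡0⇒x∉p p (suc-injective e) x∈p)
∣p∣≡1⇒p≡⁅x⁆ (outside ∷ p) e (there x∈p) = cong (outside ∷_) (∣p∣≡1⇒p≡⁅x⁆ p e x∈p)

∣p∪q∣≤∣p∣+∣q∣ : ∀ (p q : Subset n) → ∣ p ∪ q ∣ ≤ ∣ p ∣ + ∣ q ∣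
∣p∪q∣≤∣p∣+∣q∣ [] [] = z≤n
∣p∪q∣≤∣p∣+∣q∣ (inside ∷ p) (inside ∷ q) = s≤s (≤-trans (∣p∪q∣≤∣p∣+∣q∣ p q) (+-monoʳ-≤ ∣ p ∣ (n≤1+n _)))
∣p∪q∣≤∣p∣+∣q∣ (inside ∷ p) (outside ∷ q) = s≤s (∣p∪q∣≤∣p∣+∣q∣ p q)
∣p∪q∣≤∣p∣+∣q∣ (outside ∷ p) (inside ∷ q) = ≤-trans (s≤s (∣p∪q∣≤∣p∣+∣q∣ p q)) (≤-reflexive (sym (+-suc _ _)))
∣p∪q∣≤∣p∣+∣q∣ (outside ∷ p) (outside ∷ q) = ∣p∪q∣≤∣p∣+∣q∣ p q

image : (Fin n → Fin k) → Subset n → Subset k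
image g [] = ∅
image g (inside ∷ p) = ⁅ g zero ⁆ ∪ image (g ∘ suc) p
image g (outside ∷ p) = image (g ∘ suc) p

∈-image : ∀ (g : Fin n → Fin k) (p : Subset n) {x} → x ∈ p → g x ∈ image g p
∈-image g (inside ∷ p) here = x∈p∪q⁺ (inj₁ (x∈⁅x⁆ (g zero)))
∈-image g (inside ∷ p) (there x∈p) = x∈p∪q⁺ (inj₂ (∈-image (g ∘ suc) p x∈p))
∈-image g (outside ∷ p) (there x∈p) = ∈-image (g ∘ suc) p x∈p

∣image∣≤∣p∣ : ∀ (g : Fin n → Fin k) (p : Subset n) → ∣ image g p ∣ ≤ ∣ p ∣
∣image∣≤∣p∣ {k = k} g [] = ≤-reflexive (∣⊥∣≡0 k)
∣image∣≤∣p∣ g (inside ∷ p) = ≤-trans (∣p∪q∣≤∣p∣+∣q∣ ⁅ g zero ⁆ _)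
  (≤-trans (≤-reflexive (cong (_+ ∣ image (g ∘ suc) p ∣) (∣⁅x⁆∣≡1 (g zero))))
           (s≤s (∣image∣≤∣p∣ (g ∘ suc) p)))
∣image∣≤∣p∣ g (outside ∷ p) = ∣image∣≤∣p∣ (g ∘ suc) p

missing-value : ∀ (g : Fin n → Fin k) (p : Subset n) → ∣ p ∣ < k →
                ∃ λ c → ∀ z → z ∈ p → g z ≢ c
missing-value {k = k} g p ∣p∣<k with any? (λ c → ¬? (c ∈? image g p))
... | yes (c , c∉) = c , λ z z∈p gz≡c → c∉ (subst (_∈ image g p) gz≡c (∈-image g p z∈p))
... | no all-used = ⊥-elim (<-irrefl refl (≤-trans ∣p∣<k (≤-trans k≤∣image∣ (∣image∣≤∣p∣ g p))))
  where
  k≤∣image∣ : k ≤ ∣ image g p ∣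
  k≤∣image∣ = ≤-trans (≤-reflexive (sym (∣⊤∣≡n k)))
    (p⊆q⇒∣p∣≤∣q∣ {p = ⊤} λ {c} _ → decidable-stable (c ∈? image g p) (λ c∉ → all-used (c , c∉)))

module Ancestry {m : ℕ} {r : Fin m} (T : RootedTree m r) where

  infix 4 _⊑_
  data _⊑_ (w : Fin m) : Fin m → Set where
    ⊑-refl : w ⊑ w
    ⊑-step : ∀ {d} → d ≢ r → w ⊑ parent T d → w ⊑ d

  depth-parent< : ∀ {d} → d ≢ r → depth T (parent T d) < depth T d
  depth-parent< {d} d≢r = ≤-reflexive (sym (depth-step T d d≢r))

  ⊑⇒depth≤ : ∀ {w d} → w ⊑ d → depth T w ≤ depth T d
  ⊑⇒depth≤ ⊑-refl = ≤-refl
  ⊑⇒depth≤ (⊑-step d≢r w⊑pd) = ≤-trans (⊑⇒depth≤ w⊑pd) (≤-trans (n≤1+n _) (depth-parent< d≢r))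

  ⊑⇒depth< : ∀ {w d} → w ⊑ d → w ≢ d → depth T w < depth T d
  ⊑⇒depth< ⊑-refl w≢d = ⊥-elim (w≢d refl)
  ⊑⇒depth< (⊑-step d≢r w⊑pd) _ = ≤-trans (s≤s (⊑⇒depth≤ w⊑pd)) (depth-parent< d≢r)

  ⊑-trans : ∀ {a b c} → a ⊑ b → b ⊑ c → a ⊑ c
  ⊑-trans a⊑b ⊑-refl = a⊑b
  ⊑-trans a⊑b (⊑-step c≢r b⊑pc) = ⊑-step c≢r (⊑-trans a⊑b b⊑pc)

  ⊑-parent : ∀ {a d} → a ⊑ d → a ≢ d → a ⊑ parent T d
  ⊑-parent ⊑-refl a≢d = ⊥-elim (a≢d refl)
  ⊑-parent (⊑-step _ a⊑pd) _ = a⊑pd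

  parent⊑ : ∀ {d} → d ≢ r → parent T d ⊑ d
  parent⊑ d≢r = ⊑-step d≢r ⊑-refl

  ⊑-root : ∀ {w} → w ⊑ r → w ≡ r
  ⊑-root ⊑-refl = refl
  ⊑-root (⊑-step r≢r _) = ⊥-elim (r≢r refl)

  root⊑ : ∀ d → r ⊑ d
  root⊑ d = climb (depth T d) d refl
    where
    climb : ∀ j d → depth T d ≡ j → r ⊑ d
    climb j d _ with d ≟ r
    climb j d _ | yes refl = ⊑-refl
    climb zero d depth≡0 | no d≢r with trans (sym (depth-step T d d≢r)) depth≡0
    ... | ()
    climb (suc j) d depth≡ | no d≢r =
      ⊑-step d≢r (climb j (parent T d) (suc-injective (trans (sym (depth-step T d d≢r)) depth≡)))

  ⊑-total : ∀ {a b w} → a ⊑ w → b ⊑ w → a ⊑ b ⊎ b ⊑ a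
  ⊑-total ⊑-refl b⊑a = inj₂ b⊑a
  ⊑-total (⊑-step w≢r a⊑pw) ⊑-refl = inj₁ (⊑-step w≢r a⊑pw)
  ⊑-total (⊑-step _ a⊑pw) (⊑-step _ b⊑pw) = ⊑-total a⊑pw b⊑pw

  edge-up : ∀ {d} → d ≢ r → TEdge T d (parent T d)
  edge-up d≢r = inj₁ (d≢r , refl)

  edge-down : ∀ {d} → d ≢ r → TEdge T (parent T d) d
  edge-down d≢r = inj₂ (d≢r , refl)

module Bags {n m : ℕ} {G : Graph n} {r : Fin m} (D : TreeDecomposition G m r) where

  open Ancestry (tree D) public

  private
    B : Fin m → Subset n
    B = bag D

    p : Fin m → Fin m
    p = parent (tree D)

  first-node : ∀ {S : Fin m → Set} {c d} → PathIn (tree D) S c d → S c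
  first-node (here s) = s
  first-node (step s _ _) = s

  walk-stays-below : ∀ {x w} → x ∉ B (p w) →
                     ∀ {c d} → PathIn (tree D) (λ t → x ∈ B t) c d → w ⊑ c → w ⊑ d
  walk-stays-below x∉pw (here _) w⊑c = w⊑c
  walk-stays-below {x} {w} x∉pw (step {c} {v} _ (inj₁ (_ , pc≡v)) rest) w⊑c =
    walk-stays-below x∉pw rest (to-parent w⊑c)
    where
    to-parent : w ⊑ c → w ⊑ v
    to-parent ⊑-refl = ⊥-elim (x∉pw (subst (λ t → x ∈ B t) (sym pc≡v) (first-node rest)))
    to-parent (⊑-step _ w⊑pc) = subst (w ⊑_) pc≡v w⊑pc
  walk-stays-below x∉pw (step _ (inj₂ (v≢r , pv≡c)) rest) w⊑c =
    walk-stays-below x∉pw rest (⊑-step v≢r (subst (_ ⊑_) (sym pv≡c) w⊑c))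

  introduced-above : ∀ {x w d} → x ∈ B w → x ∉ B (p w) → x ∈ B d → w ⊑ d
  introduced-above {x} {w} {d} x∈w x∉pw x∈d =
    walk-stays-below x∉pw (connected D x w d x∈w x∈d) ⊑-refl

  introduced⇒∉root : ∀ {x w} → w ≢ r → x ∈ B w → x ∉ B (p w) → x ∉ B r
  introduced⇒∉root w≢r x∈w x∉pw x∈r = w≢r (⊑-root (introduced-above x∈w x∉pw x∈r))

  bag-convex : ∀ {x a b c} → x ∈ B a → x ∈ B c → a ⊑ b → b ⊑ c → x ∈ B b
  bag-convex x∈a x∈c a⊑b ⊑-refl = x∈c
  bag-convex {x} x∈a x∈c a⊑b (⊑-step {c} c≢r b⊑pc) with x ∈? B (p c)
  ... | yes x∈pc = bag-convex x∈a x∈pc a⊑b b⊑pc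
  ... | no x∉pc = ⊥-elim (n≮n _ (<-≤-trans (depth-parent< c≢r)
        (⊑⇒depth≤ (⊑-trans (introduced-above x∈c x∉pc x∈a) (⊑-trans a⊑b b⊑pc)))))

  record Introduction (x : Fin n) : Set where
    field
      node     : Fin m
      node≢r   : node ≢ r
      in-bag   : x ∈ B node
      ∉-parent : x ∉ B (p node)

    node⊑ : ∀ {d} → x ∈ B d → node ⊑ d
    node⊑ x∈d = introduced-above in-bag ∉-parent x∈d

    ∉root : x ∉ B r
    ∉root = introduced⇒∉root node≢r in-bag ∉-parent
  open Introduction public

  introduction : ∀ {x} → x ∉ B r → Introduction x
  introduction {x} x∉r = climb (proj₂ (nonempty D x)) (root⊑ _)
    where
    climb : ∀ {d} → x ∈ B d → r ⊑ d → Introduction x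
    climb x∈d ⊑-refl = ⊥-elim (x∉r x∈d)
    climb x∈d (⊑-step {d} d≢r r⊑pd) with x ∈? B (p d)
    ... | yes x∈pd = climb x∈pd r⊑pd
    ... | no x∉pd = record { node = d ; node≢r = d≢r ; in-bag = x∈d ; ∉-parent = x∉pd }

module Completeness {n m ℓ : ℕ} {G : Graph n} {r : Fin m} (D : TreeDecomposition G m r)
                    (complete : IsComplete ℓ D) where

  private
    B : Fin m → Subset n
    B = bag D

  ∣difference∣≡1 : ∀ {w w′} → TEdge (tree D) w w′ → ∣ B w ─ B w′ ∣ ≡ 1
  ∣difference∣≡1 {w} {w′} e = +-cancelʳ-≡ ℓ _ 1 (begin
    ∣ B w ─ B w′ ∣ + ℓ                ≡⟨ cong (∣ B w ─ B w′ ∣ +_) (sym (proj₂ complete w w′ e)) ⟩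
    ∣ B w ─ B w′ ∣ + ∣ B w ∩ B w′ ∣   ≡⟨ sym (∣p∣≡∣p─q∣+∣p∩q∣ (B w) (B w′)) ⟩
    ∣ B w ∣                           ≡⟨ proj₁ complete w ⟩
    1 + ℓ                             ∎)
    where open ≡-Reasoning

  difference≡⁅_⁆ : ∀ {w w′} y → TEdge (tree D) w w′ → y ∈ B w → y ∉ B w′ → B w ─ B w′ ≡ ⁅ y ⁆
  difference≡⁅ y ⁆ e y∈w y∉w′ = ∣p∣≡1⇒p≡⁅x⁆ _ (∣difference∣≡1 e) (x∈p∧x∉q⇒x∈p─q y∈w y∉w′)

  difference-element : ∀ {w w′} → TEdge (tree D) w w′ →
                       ∃ λ x → x ∈ B w × x ∉ B w′ × B w ─ B w′ ≡ ⁅ x ⁆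
  difference-element {w} {w′} e with ∣p∣≡1⇒nonempty (B w ─ B w′) (∣difference∣≡1 e)
  ... | x , x∈ with ∈─⁻ (B w) (B w′) x∈
  ...   | x∈w , x∉w′ = x , x∈w , x∉w′ , difference≡⁅ x ⁆ e x∈w x∉w′

  bag-small : ∀ {k} → ℓ + 2 ≤ k → ∀ w → ∣ B w ∣ < k
  bag-small ℓ+2≤k w =
    ≤-trans (≤-reflexive (cong suc (proj₁ complete w))) (≤-trans (≤-reflexive (+-comm 2 ℓ)) ℓ+2≤k)

-- Recolouring a pending vertex of maximal
-- key then keeps the colouring proper and Ordered, and shrinks the pending
-- set, so β is reached recolouring only pending vertices, each once.

module Recolouring {n k : ℕ} (G : Graph n) (β : Coloring n k) (β-proper : Proper G β)
                   (key : Fin n → ℕ) where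

  Pending : Coloring n k → Fin n → Set
  Pending γ x = γ x ≢ β x

  pending? : ∀ γ x → Dec (Pending γ x)
  pending? γ x = ¬? (γ x ≟ β x)

  Ordered : Coloring n k → Set
  Ordered γ = ∀ x z → Adj G x z → Pending γ x → Pending γ z → γ z ≡ β x → key x < key z

  record Reconfiguration (γ : Coloring n k) : Set where
    field
      length       : ℕ
      seq          : Fin (suc length) → Coloring n k
      starts       : ∀ x → seq zero x ≡ γ x
      ends         : ∀ x → seq (fromℕ length) x ≡ β x
      proper       : ∀ i → Proper G (seq i)
      single       : ∀ (i : Fin length) → DifferOnOne (seq (inject₁ i)) (seq (suc i))
      only-pending : ∀ (i : Fin length) x → Recolored (seq (inject₁ i)) (seq (suc i)) x → Pending γ x
      at-most-once : ∀ (i j : Fin length) x → Recolored (seq (inject₁ i)) (seq (suc i)) x →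
                     Recolored (seq (inject₁ j)) (seq (suc j)) x → i ≡ j

  stay : ∀ {γ} → Proper G γ → (∀ x → γ x ≡ β x) → Reconfiguration γ
  stay {γ} γ-proper γ≗β = record
    { length = 0 ; seq = λ _ → γ ; starts = λ _ → refl ; ends = γ≗β
    ; proper = λ _ → γ-proper ; single = λ () ; only-pending = λ () ; at-most-once = λ () }

  recolour : Coloring n k → Fin n → Coloring n k
  recolour γ v = updateAt γ v (λ _ → β v)

  recolour-at : ∀ γ v → recolour γ v v ≡ β v
  recolour-at γ v = updateAt-updates v γ

  recolour-off : ∀ γ {v x} → x ≢ v → recolour γ v x ≡ γ x
  recolour-off γ {v} {x} x≢v = updateAt-minimal x v γ x≢v

  pending-after : ∀ {γ v x} → Pending (recolour γ v) x → x ≢ v × Pending γ x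
  pending-after {γ} {v} {x} px with x ≟ v
  ... | yes refl = ⊥-elim (px (recolour-at γ v))
  ... | no x≢v = x≢v , λ γx≡βx → px (trans (recolour-off γ x≢v) γx≡βx)

  -- Recolouring v first and then following a sequence for the result gives a
  -- sequence for γ; v is never touched again since it is no longer pending.
  prepend : ∀ {γ} v → Pending γ v → Proper G γ →
            Reconfiguration (recolour γ v) → Reconfiguration γ
  prepend {γ} v pv γ-proper R = record
    { length = suc length
    ; seq = seq′
    ; starts = λ _ → refl
    ; ends = ends
    ; proper = λ { zero → γ-proper ; (suc i) → proper i }
    ; single = λ { zero → v , moves-v , (λ z z≢v → sym (trans (starts z) (recolour-off γ z≢v)))
                 ; (suc i) → single i }
    ; only-pending = λ { zero x r → subst (Pending γ) (sym (only-v r)) pv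
                       ; (suc i) x r → proj₂ (pending-after (only-pending i x r)) }
    ; at-most-once = λ { zero zero x _ _ → refl
                       ; zero (suc j) x r r′ → ⊥-elim (proj₁ (pending-after (only-pending j x r′)) (only-v r))
                       ; (suc i) zero x r r′ → ⊥-elim (proj₁ (pending-after (only-pending i x r)) (only-v r′))
                       ; (suc i) (suc j) x r r′ → cong suc (at-most-once i j x r r′) }
    }
    where
    open Reconfiguration R

    seq′ : Fin (suc (suc length)) → Coloring n k
    seq′ zero = γ
    seq′ (suc i) = seq i

    moves-v : γ v ≢ seq zero v
    moves-v γv≡ = pv (trans γv≡ (trans (starts v) (recolour-at γ v)))

    only-v : ∀ {x} → γ x ≢ seq zero x → x ≡ v
    only-v {x} r with x ≟ v
    ... | yes x≡v = x≡v
    ... | no x≢v = ⊥-elim (r (sym (trans (starts x) (recolour-off γ x≢v))))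

  -- The pending vertices as a subset, to measure progress.
  pending-set : Coloring n k → Subset n
  pending-set γ = tabulate (λ x → does (pending? γ x))

  pending⇒∈ : ∀ {γ x} → Pending γ x → x ∈ pending-set γ
  pending⇒∈ {γ} {x} px = lookup⇒[]= x _ (trans (lookup∘tabulate _ x) (dec-true (pending? γ x) px))

  ∈⇒pending : ∀ {γ x} → x ∈ pending-set γ → Pending γ x
  ∈⇒pending {γ} {x} x∈ γx≡βx with trans (sym ([]=⇒lookup x∈)) (trans (lookup∘tabulate _ x)
                                        (dec-false (pending? γ x) (λ px → px γx≡βx)))
  ... | ()

  pending-shrinks : ∀ {γ v} → Pending γ v → pending-set (recolour γ v) ⊂ pending-set γ
  pending-shrinks {γ} {v} pv =
    (λ x∈ → pending⇒∈ {γ} (proj₂ (pending-after {γ} {v} (∈⇒pending {recolour γ v} x∈)))) ,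
    v , pending⇒∈ {γ} pv , λ v∈ → proj₁ (pending-after {γ} {v} (∈⇒pending {recolour γ v} v∈)) refl

  maximal-pending : ∀ {γ v} → Pending γ v →
                    ∃ λ w → Pending γ w × (∀ z → Pending γ z → key z ≤ key w)
  maximal-pending {γ} {v} pv =
    w , argmax-all key {P = Pending γ} pv (All.tabulate (proj₂ ∘ ∈-filter⁻ (pending? γ) {xs = allFin n})) ,
    bound
    where
    others : List (Fin n)
    others = filter (pending? γ) (allFin n)

    w : Fin n
    w = argmax key v others

    bound : ∀ z → Pending γ z → key z ≤ key w
    bound z pz = All.lookup (f[xs]≤f[argmax] v others) (∈-filter⁺ (pending? γ) (∈-allFin z) pz)

  module _ {γ : Coloring n k} (γ-proper : Proper G γ) (γ-ordered : Ordered γ)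
           {v : Fin n} (pv : Pending γ v) (v-max : ∀ z → Pending γ z → key z ≤ key v) where

    target-free : ∀ y → Adj G v y → β v ≢ γ y
    target-free y adj βv≡γy with γ y ≟ β y
    ... | yes γy≡βy = β-proper v y adj (trans βv≡γy γy≡βy)
    ... | no py = n≮n _ (<-≤-trans (γ-ordered v y adj pv py (sym βv≡γy)) (v-max y py))

    recolour-proper : Proper G (recolour γ v)
    recolour-proper x y adj eq with x ≟ v | y ≟ v
    ... | yes refl | yes refl = loopless G adj
    ... | yes refl | no y≢v =
      target-free y adj (trans (sym (recolour-at γ v)) (trans eq (recolour-off γ y≢v)))
    ... | no x≢v | yes refl =
      target-free x (symAdj G adj) (trans (sym (recolour-at γ v)) (trans (sym eq) (recolour-off γ x≢v)))
    ... | no x≢v | no y≢v =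
      γ-proper x y adj (trans (sym (recolour-off γ x≢v)) (trans eq (recolour-off γ y≢v)))

    recolour-ordered : Ordered (recolour γ v)
    recolour-ordered x z adj px pz eq with pending-after {γ} px | pending-after {γ} pz
    ... | _ , px′ | z≢v , pz′ = γ-ordered x z adj px′ pz′ (trans (sym (recolour-off γ z≢v)) eq)

  reconfigure : ∀ {γ} → Proper G γ → Ordered γ → Reconfiguration γ
  reconfigure {γ} = go (suc ∣ pending-set γ ∣) γ ≤-refl
    where
    go : ∀ fuel δ → ∣ pending-set δ ∣ < fuel → Proper G δ → Ordered δ → Reconfiguration δ
    go zero δ () _ _
    go (suc fuel) δ bound δ-proper δ-ordered with any? (pending? δ)
    ... | no none = stay δ-proper settled
      where
      settled : ∀ x → δ x ≡ β x
      settled x with δ x ≟ β x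
      ... | yes δx≡βx = δx≡βx
      ... | no px = ⊥-elim (none (x , px))
    ... | yes (v , pv) with maximal-pending pv
    ...   | w , pw , w-max = prepend w pw δ-proper
      (go fuel (recolour δ w) (<-≤-trans (p⊂q⇒∣p∣<∣q∣ (pending-shrinks pw)) (s≤s⁻¹ bound))
          (recolour-proper δ-proper δ-ordered pw w-max) (recolour-ordered δ-proper δ-ordered pw w-max))

module Construction (k ℓ : ℕ) (ℓ+2≤k : ℓ + 2 ≤ k) {n m : ℕ} (G : Graph n) (u : Fin m)
    (D : TreeDecomposition G m u) (complete : IsComplete ℓ D)
    (α : Coloring n k) (α-proper : Proper G α) (α-coherent : Coherent D (λ x → x ∉ bag D u) α)
    (a : Fin k) (a∉root : ∀ x → x ∈ bag D u → α x ≢ a) where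

  open Bags D
  open Completeness D complete

  private
    B : Fin m → Subset n
    B = bag D

    p : Fin m → Fin m
    p = parent (tree D)

  fresh : Fin m → Fin k
  fresh w = proj₁ (missing-value α (B w) (bag-small ℓ+2≤k w))

  fresh-absent : ∀ w z → z ∈ B w → α z ≢ fresh w
  fresh-absent w = proj₂ (missing-value α (B w) (bag-small ℓ+2≤k w))

  Occurs : Fin k → Fin m → Set
  Occurs c w = ∃ λ z → z ∈ B w × α z ≡ c

  occurs? : ∀ c w → Dec (Occurs c w)
  occurs? c w = any? (λ z → (z ∈? B w) ×-dec (α z ≟ c))

  pass : Fin k → Fin m → Fin k
  pass c w with occurs? c w
  ... | yes _ = fresh w
  ... | no _ = c

  banned-within : ℕ → Fin m → Fin k
  banned-within zero w = a
  banned-within (suc j) w = pass (banned-within j (p w)) w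

  banned : Fin m → Fin k
  banned w = banned-within (depth (tree D) w) w

  banned-root : banned u ≡ a
  banned-root rewrite depth-root (tree D) = refl

  banned-child : ∀ w → w ≢ u → banned w ≡ pass (banned (p w)) w
  banned-child w w≢u rewrite depth-step (tree D) w w≢u = refl

  Active : Fin m → Set
  Active e = e ≢ u × Occurs (banned (p e)) e

  banned-active : ∀ {e} → Active e → banned e ≡ fresh e
  banned-active {e} (e≢u , occ) with occurs? (banned (p e)) e | banned-child e e≢u
  ... | yes _ | eq = eq
  ... | no ¬occ | _ = ⊥-elim (¬occ occ)

  banned-inactive : ∀ {e} → e ≢ u → ¬ Occurs (banned (p e)) e → banned e ≡ banned (p e)
  banned-inactive {e} e≢u ¬occ with occurs? (banned (p e)) e | banned-child e e≢u
  ... | yes occ | _ = ⊥-elim (¬occ occ)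
  ... | no _ | eq = eq

  banned-absent : ∀ w z → z ∈ B w → α z ≢ banned w
  banned-absent w z z∈w αz≡ with w ≟ u
  ... | yes refl = a∉root z z∈w (trans αz≡ banned-root)
  ... | no w≢u with occurs? (banned (p w)) w
  ...   | yes occ = fresh-absent w z z∈w (trans αz≡ (banned-active (w≢u , occ)))
  ...   | no ¬occ = ¬occ (z , z∈w , trans αz≡ (banned-inactive w≢u ¬occ))

  -- Colours of vertices outside B u persist into all lower bags: when the
  -- vertex leaves, its replacement is its parent and so (coherence of α) has
  -- the same colour.
  colour-persists : ∀ {w d y} → w ⊑ d → y ∈ B w → y ∉ B u →
                    ∃ λ y′ → y′ ∈ B d × α y′ ≡ α y × y′ ∉ B u
  colour-persists ⊑-refl y∈w y∉u = _ , y∈w , refl , y∉u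
  colour-persists (⊑-step {d} d≢u w⊑pd) y∈w y∉u with colour-persists w⊑pd y∈w y∉u
  ... | y′ , y′∈pd , same , y′∉u with y′ ∈? B d
  ...   | yes y′∈d = y′ , y′∈d , same , y′∉u
  ...   | no y′∉d with difference-element (edge-up d≢u)
  ...     | x , x∈d , x∉pd , entering =
    x , x∈d , trans (proj₁ α-coherent x y′ x∉u y′∉u parents) same , x∉u
    where
    x∉u : x ∉ B u
    x∉u = introduced⇒∉root d≢u x∈d x∉pd

    parents : Parents D x y′
    parents = d , p d , edge-up d≢u , entering , difference≡⁅ y′ ⁆ (edge-down d≢u) y′∈pd y′∉d

  active-persists : ∀ {e d} → Active e → e ⊑ d → Occurs (banned (p e)) d
  active-persists (e≢u , z , z∈e , αz≡) e⊑d with z ∈? B (p _)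
  ... | yes z∈pe = ⊥-elim (banned-absent _ z z∈pe αz≡)
  ... | no z∉pe with colour-persists e⊑d z∈e (introduced⇒∉root e≢u z∈e z∉pe)
  ...   | y , y∈d , same , _ = y , y∈d , trans same αz≡

  banned-along : ∀ {s d} → s ⊑ d →
                 banned d ≡ banned s ⊎ ∃ λ w → Active w × banned (p w) ≡ banned s × w ⊑ d
  banned-along ⊑-refl = inj₁ refl
  banned-along (⊑-step {d} d≢u s⊑pd) with banned-along s⊑pd
  ... | inj₂ (w , act , same , w⊑pd) = inj₂ (w , act , same , ⊑-step d≢u w⊑pd)
  ... | inj₁ same with occurs? (banned (p d)) d
  ...   | yes occ = inj₂ (d , (d≢u , occ) , same , ⊑-refl)
  ...   | no ¬occ = inj₁ (trans (banned-inactive d≢u ¬occ) same)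

  banned-persists : ∀ {s d} → Active d → s ⊑ p d → Occurs (banned s) d
  banned-persists {s} {d} (d≢u , occ) s⊑pd with banned-along s⊑pd
  ... | inj₁ same = subst (λ c → Occurs c d) same occ
  ... | inj₂ (w , act , same , w⊑pd) =
    subst (λ c → Occurs c d) same (active-persists act (⊑-step d≢u w⊑pd))

  record Trigger (v : Fin n) (e : Fin m) : Set where
    constructor trigger
    field
      active : Active e
      colour : α v ≡ banned (p e)
  open Trigger

  trigger? : ∀ v e → Dec (Trigger v e)
  trigger? v e = map′ (λ ((e≢u , occ) , col) → trigger (e≢u , occ) col) (λ t → active t , colour t)
    ((¬? (e ≟ u) ×-dec occurs? (banned (p e)) e) ×-dec (α v ≟ banned (p e)))

  trigger-recolours : ∀ {v e} → Trigger v e → α v ≢ fresh e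
  trigger-recolours {v} {e} t αv≡ with active t
  ... | _ , z , z∈e , αz≡ = fresh-absent e z z∈e (trans αz≡ (trans (sym (colour t)) αv≡))

  trigger-above : ∀ {s d v} → s ⊑ p d → d ≢ u → v ∈ B d → α v ≡ banned s →
                  ∃ λ w → Trigger v w × w ⊑ d
  trigger-above s⊑pd d≢u v∈d αv≡ with banned-along s⊑pd
  ... | inj₁ same = _ , trigger (d≢u , _ , v∈d , trans αv≡ (sym same)) (trans αv≡ (sym same)) , ⊑-refl
  ... | inj₂ (w , act , same , w⊑pd) = w , trigger act (trans αv≡ (sym same)) , ⊑-step d≢u w⊑pd

  trigger-unique : ∀ {x y e e′} → Trigger x e → Trigger y e′ → α x ≡ α y → e ⊑ e′ → e ≡ e′
  trigger-unique {e = e} {e′} tx ty αx≡αy e⊑e′ with e ≟ e′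
  ... | yes e≡e′ = e≡e′
  ... | no e≢e′ with active-persists (active tx) (⊑-parent e⊑e′ e≢e′)
  ...   | z , z∈pe′ , αz≡ = ⊥-elim (banned-absent _ z z∈pe′
          (trans αz≡ (trans (sym (colour tx)) (trans αx≡αy (colour ty)))))

  trigger-unique-either : ∀ {x y e e′} → Trigger x e → Trigger y e′ → α x ≡ α y →
                          e ⊑ e′ ⊎ e′ ⊑ e → e ≡ e′
  trigger-unique-either tx ty αx≡αy (inj₁ e⊑e′) = trigger-unique tx ty αx≡αy e⊑e′
  trigger-unique-either tx ty αx≡αy (inj₂ e′⊑e) = sym (trigger-unique ty tx (sym αx≡αy) e′⊑e)

  -- A trigger of y above some bag containing y lies above y's introduction
  -- node (below it, y would be in the parent bag, which bans α y).
  trigger⊑introduction : ∀ {y e d} (J : Introduction y) → Trigger y e → e ⊑ d → y ∈ B d → e ⊑ node J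
  trigger⊑introduction {y} {e} J t e⊑d y∈d with ⊑-total e⊑d (node⊑ J y∈d)
  ... | inj₁ e⊑J = e⊑J
  ... | inj₂ J⊑e with node J ≟ e
  ...   | yes refl = ⊑-refl
  ...   | no J≢e = ⊥-elim (banned-absent (p e) y
          (bag-convex (in-bag J) y∈d (⊑-parent J⊑e J≢e) (⊑-trans (parent⊑ (proj₁ (active t))) e⊑d))
          (colour t))

  TriggeredBy : Fin n → Fin m → Set
  TriggeredBy v d = ∃ λ e → Trigger v e × e ⊑ d

  triggered? : ∀ v {d} → u ⊑ d → Dec (TriggeredBy v d)
  triggered? v ⊑-refl = no λ (e , t , e⊑u) → proj₁ (active t) (⊑-root e⊑u)
  triggered? v (⊑-step {d} d≢u u⊑pd) with trigger? v d
  ... | yes t = yes (d , t , ⊑-refl)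
  ... | no ¬t = map′ (λ (e , t , e⊑pd) → e , t , ⊑-step d≢u e⊑pd) below (triggered? v u⊑pd)
    where
    below : TriggeredBy v d → TriggeredBy v (p d)
    below (e , t , ⊑-refl) = ⊥-elim (¬t t)
    below (e , t , ⊑-step _ e⊑pd) = e , t , e⊑pd

  data Fate (v : Fin n) : Set where
    in-root : v ∈ B u → Fate v
    kept    : (I : Introduction v) → ¬ TriggeredBy v (node I) → Fate v
    moved   : (I : Introduction v) (e : Fin m) → Trigger v e → e ⊑ node I → Fate v

  fate : ∀ v → Fate v
  fate v with v ∈? B u
  ... | yes v∈u = in-root v∈u
  ... | no v∉u = classify (introduction v∉u)
    where
    classify : Introduction v → Fate v
    classify I with triggered? v (root⊑ (node I))
    ... | yes (e , t , e⊑I) = moved I e t e⊑I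
    ... | no none = kept I none

  new-colour : ∀ {v} → Fate v → Fin k
  new-colour {v} (in-root _) = α v
  new-colour {v} (kept _ _) = α v
  new-colour (moved _ e _ _) = fresh e

  rank : ∀ {v} → Fate v → ℕ
  rank (in-root _) = 0
  rank (kept _ _) = 0
  rank (moved _ e _ _) = depth (tree D) e

  β : Coloring n k
  β v = new-colour (fate v)

  key : Fin n → ℕ
  key v = rank (fate v)

  moved-below : ∀ {v e w} (I : Introduction v) → e ⊑ node I → v ∈ B w → e ⊑ w
  moved-below I e⊑I v∈w = ⊑-trans e⊑I (node⊑ I v∈w)

  β-root : ∀ v → v ∈ B u → β v ≡ α v
  β-root v v∈u with fate v
  ... | in-root _ = refl
  ... | kept I _ = ⊥-elim (∉root I v∈u)
  ... | moved I _ _ _ = ⊥-elim (∉root I v∈u)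

  recoloured-outside : ∀ x → α x ≢ β x → x ∉ B u
  recoloured-outside x changed x∈u = changed (sym (β-root x x∈u))

  -- β avoids a: a kept vertex of colour a would have a trigger, and a moved
  -- vertex gets fresh e although a occurs in B e.
  β-avoids : ∀ v → β v ≢ a
  β-avoids v with fate v
  ... | in-root v∈u = a∉root v v∈u
  ... | kept I none = λ αv≡a →
    none (trigger-above (root⊑ _) (node≢r I) (in-bag I) (trans αv≡a (sym banned-root)))
  ... | moved I e t _ with banned-persists (active t) (root⊑ (p e))
  ...   | y , y∈e , αy≡ = λ fresh≡a → fresh-absent e y y∈e (trans αy≡ (trans banned-root (sym fresh≡a)))

  root-avoids-fresh : ∀ {z w e} → z ∈ B u → z ∈ B w → e ⊑ w → α z ≢ fresh e
  root-avoids-fresh z∈u z∈w e⊑w = fresh-absent _ _ (bag-convex z∈u z∈w (root⊑ _) e⊑w)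

  kept-avoids-fresh : ∀ {x z w e} (I : Introduction z) → ¬ TriggeredBy z (node I) →
                      Trigger x e → e ⊑ w → z ∈ B w → α z ≢ fresh e
  kept-avoids-fresh {z = z} {e = e} I none t e⊑w z∈w αz≡ with ⊑-total e⊑w (node⊑ I z∈w)
  ... | inj₂ I⊑e = fresh-absent e z (bag-convex (in-bag I) z∈w I⊑e e⊑w) αz≡
  ... | inj₁ e⊑I with e ≟ node I
  ...   | yes refl = fresh-absent e z (in-bag I) αz≡
  ...   | no e≢I = none (trigger-above (⊑-parent e⊑I e≢I) (node≢r I) (in-bag I)
                                       (trans αz≡ (sym (banned-active (active t)))))

  fresh-distinct : ∀ {e e′} → Active e → Active e′ → e ⊑ e′ → e ≢ e′ → fresh e ≢ fresh e′
  fresh-distinct {e} {e′} act act′ e⊑e′ e≢e′ fresh≡ with banned-persists act′ (⊑-parent e⊑e′ e≢e′)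
  ... | y , y∈e′ , αy≡ = fresh-absent e′ y y∈e′ (trans αy≡ (trans (banned-active act) fresh≡))

  moved-separated : ∀ {x z w e e′} → x ∉ B u → x ∈ B w → z ∈ B w → Trigger x e → Trigger z e′ →
                    e ⊑ w → e′ ⊑ w → fresh e′ ≡ fresh e → z ≡ x
  moved-separated {x} {z} {w} {e} {e′} x∉u x∈w z∈w tx tz e⊑w e′⊑w fresh≡ with e ≟ e′
  ... | yes refl = proj₂ α-coherent w x x∉u x∈w z z∈w (trans (colour tz) (sym (colour tx)))
  ... | no e≢e′ with ⊑-total e⊑w e′⊑w
  ...   | inj₁ e⊑e′ = ⊥-elim (fresh-distinct (active tx) (active tz) e⊑e′ e≢e′ (sym fresh≡))
  ...   | inj₂ e′⊑e = ⊥-elim (fresh-distinct (active tz) (active tx) e′⊑e (e≢e′ ∘ sym) fresh≡)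

  β-separates : ∀ w x → x ∉ B u → x ∈ B w → ∀ z → z ∈ B w → β z ≡ β x → z ≡ x
  β-separates w x x∉u x∈w z z∈w eq with fate x | fate z
  ... | in-root x∈u | _ = ⊥-elim (x∉u x∈u)
  ... | kept _ _ | in-root _ = proj₂ α-coherent w x x∉u x∈w z z∈w eq
  ... | kept _ _ | kept _ _ = proj₂ α-coherent w x x∉u x∈w z z∈w eq
  ... | kept I none | moved J e′ t′ e′⊑J =
    ⊥-elim (kept-avoids-fresh I none t′ (moved-below J e′⊑J z∈w) x∈w (sym eq))
  ... | moved I e t e⊑I | in-root z∈u = ⊥-elim (root-avoids-fresh z∈u z∈w (moved-below I e⊑I x∈w) eq)
  ... | moved I e t e⊑I | kept J none = ⊥-elim (kept-avoids-fresh J none t (moved-below I e⊑I x∈w) z∈w eq)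
  ... | moved I e t e⊑I | moved J e′ t′ e′⊑J =
    moved-separated x∉u x∈w z∈w t t′ (moved-below I e⊑I x∈w) (moved-below J e′⊑J z∈w) eq

  -- Adjacent vertices share a bag, so properness follows from separation.
  β-proper : Proper G β
  β-proper x y adj eq = clash (covers D x y adj) (x ∈? B u) (y ∈? B u)
    where
    clash : (∃ λ w → x ∈ B w × y ∈ B w) → Dec (x ∈ B u) → Dec (y ∈ B u) → ⊥
    clash (w , x∈w , y∈w) (no x∉u) _ =
      loopless G (subst (Adj G x) (β-separates w x x∉u x∈w y y∈w (sym eq)) adj)
    clash (w , x∈w , y∈w) (yes _) (no y∉u) =
      loopless G (subst (λ t → Adj G t y) (β-separates w y y∉u y∈w x x∈w eq) adj)
    clash _ (yes x∈u) (yes y∈u) =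
      α-proper x y adj (trans (sym (β-root x x∈u)) (trans eq (β-root y y∈u)))

  -- The first half of coherence, for x entering at w and y in the parent bag:
  -- equal α-colours have the same trigger, if any.
  β-parent-step : ∀ {w x y} → w ≢ u → x ∈ B w → x ∉ B (p w) → y ∈ B (p w) →
                  x ∉ B u → y ∉ B u → α x ≡ α y → β x ≡ β y
  β-parent-step {w} {x} {y} w≢u x∈w x∉pw y∈pw x∉u y∉u αx≡αy with fate x | fate y
  ... | in-root x∈u | _ = ⊥-elim (x∉u x∈u)
  ... | kept _ _ | in-root y∈u = ⊥-elim (y∉u y∈u)
  ... | moved _ _ _ _ | in-root y∈u = ⊥-elim (y∉u y∈u)
  ... | kept _ _ | kept _ _ = αx≡αy
  ... | moved I e t e⊑I | moved J e′ t′ e′⊑J =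
    cong fresh (trigger-unique-either t t′ αx≡αy (⊑-total (moved-below I e⊑I x∈w) e′⊑w))
    where
    e′⊑w : e′ ⊑ w
    e′⊑w = ⊑-trans (moved-below J e′⊑J y∈pw) (parent⊑ w≢u)
  ... | kept I none | moved J e′ t′ e′⊑J =
    ⊥-elim (none (e′ , tx , trigger⊑introduction I tx e′⊑w x∈w))
    where
    tx : Trigger x e′
    tx = trigger (active t′) (trans αx≡αy (colour t′))

    e′⊑w : e′ ⊑ w
    e′⊑w = ⊑-trans (moved-below J e′⊑J y∈pw) (parent⊑ w≢u)
  ... | moved I e t e⊑I | kept J none with e ≟ w
  ...   | yes refl = ⊥-elim (banned-absent (p e) y y∈pw (trans (sym αx≡αy) (colour t)))
  ...   | no e≢w =
    ⊥-elim (none (e , ty , trigger⊑introduction J ty (⊑-parent (moved-below I e⊑I x∈w) e≢w) y∈pw))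
    where
    ty : Trigger y e
    ty = trigger (active t) (trans (sym αx≡αy) (colour t))

  β-parents : ∀ x y → x ∉ B u → y ∉ B u → Parents D x y → β x ≡ β y
  β-parents x y x∉u y∉u par@(w , w′ , edge , leaves-x , leaves-y)
    with ∈─⁻ (B w) (B w′) (subst (x ∈_) (sym leaves-x) (x∈⁅x⁆ x))
       | ∈─⁻ (B w′) (B w) (subst (y ∈_) (sym leaves-y) (x∈⁅x⁆ y))
  ... | x∈w , x∉w′ | y∈w′ , y∉w with edge
  ...   | inj₁ (w≢u , refl) = β-parent-step w≢u x∈w x∉w′ y∈w′ x∉u y∉u αx≡αy
    where αx≡αy = proj₁ α-coherent x y x∉u y∉u par
  ...   | inj₂ (w′≢u , refl) = sym (β-parent-step w′≢u y∈w′ y∉w x∈w y∉u x∉u (sym αx≡αy))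
    where αx≡αy = proj₁ α-coherent x y x∉u y∉u par

  β-coherent : Coherent D (λ x → x ∉ B u) β
  β-coherent = β-parents , β-separates

  -- α is Ordered for β and key: if a neighbour z of x holds β x = fresh e,
  -- the trigger of z lies strictly below e.
  blocking-is-deeper : ∀ x z → Adj G x z → α x ≢ β x → α z ≢ β z → α z ≡ β x → key x < key z
  blocking-is-deeper x z adj cx cz αz≡βx with covers D x z adj | fate x | fate z
  ... | _ | in-root _ | _ = ⊥-elim (cx refl)
  ... | _ | kept _ _ | _ = ⊥-elim (cx refl)
  ... | _ | moved _ _ _ _ | in-root _ = ⊥-elim (cz refl)
  ... | _ | moved _ _ _ _ | kept _ _ = ⊥-elim (cz refl)
  ... | w , x∈w , z∈w | moved I e _ e⊑I | moved J e′ t′ e′⊑J with e ≟ e′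
  ...   | yes refl = ⊥-elim (trigger-recolours t′ αz≡βx)
  ...   | no e≢e′ with ⊑-total (moved-below I e⊑I x∈w) (moved-below J e′⊑J z∈w)
  ...     | inj₁ e⊑e′ = ⊑⇒depth< e⊑e′ e≢e′
  ...     | inj₂ e′⊑e with active-persists (active t′) e′⊑e
  ...       | y , y∈e , αy≡ = ⊥-elim (fresh-absent e y y∈e (trans αy≡ (trans (sym (colour t′)) αz≡βx)))

coherent-≗ : ∀ {n m r k} {G : Graph n} (D : TreeDecomposition G m r) {X : Fin n → Set}
             {γ γ′ : Coloring n k} → (∀ x → γ x ≡ γ′ x) → Coherent D X γ → Coherent D X γ′
coherent-≗ D γ≗γ′ (parents-agree , separated) =
  (λ x y X-x X-y par → trans (sym (γ≗γ′ x)) (trans (parents-agree x y X-x X-y par) (γ≗γ′ y))) ,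
  (λ w x X-x x∈w z z∈w eq → separated w x X-x x∈w z z∈w (trans (γ≗γ′ z) (trans eq (sym (γ≗γ′ x)))))

lemma6 : (k ℓ : ℕ) → ℓ + 2 ≤ k →
    {n m : ℕ} (G : Graph n) (u : Fin m) (D : TreeDecomposition G m u) →
    IsComplete ℓ D →
    (α : Coloring n k) → Proper G α →
    Coherent D (λ x → x ∉ bag D u) α →
    (a : Fin k) → (∀ x → x ∈ bag D u → α x ≢ a) →
    Σ ℕ λ t → Σ (Fin (suc t) → Coloring n k) λ seq →
      (∀ x → seq zero x ≡ α x) ×
      (∀ i → Proper G (seq i)) ×
      (∀ (i : Fin t) → DifferOnOne (seq (inject₁ i)) (seq (suc i))) ×
      (∀ (i : Fin t) x → Recolored (seq (inject₁ i)) (seq (suc i)) x → x ∉ bag D u) ×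
      (∀ (i j : Fin t) x → Recolored (seq (inject₁ i)) (seq (suc i)) x →
         Recolored (seq (inject₁ j)) (seq (suc j)) x → i ≡ j) ×
      Coherent D (λ x → x ∉ bag D u) (seq (fromℕ t)) ×
      (∀ x → seq (fromℕ t) x ≢ a)
lemma6 k ℓ ℓ+2≤k G u D complete α α-proper α-coherent a a∉root =
  length , seq , starts , proper , single ,
  (λ i x recoloured → recoloured-outside x (only-pending i x recoloured)) ,
  at-most-once ,
  coherent-≗ D (λ x → sym (ends x)) β-coherent ,
  (λ x last≡a → β-avoids x (trans (sym (ends x)) last≡a))
  where
  open Construction k ℓ ℓ+2≤k G u D complete α α-proper α-coherent a a∉root
  open Recolouring G β β-proper key
  open Reconfiguration (reconfigure α-proper blocking-is-deeper)
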